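{- Let $G$ be a toroidal triangulation and $f_0$ a face of $G$. The minimal element of the lattice $(O(G),\le_{f_0})$ is the only HTC Schnyder wood of $G$ that contains no non-empty $0$-homologous oriented subgraph that is clockwise w.r.t. $f_0$.
   Context: Graphs embedded on surfaces may have loops and multiple edges but no contractible cycle of length 1 or 2; a toroidal triangulation is a map on the torus (faces are open disks) all of whose faces are triangles. Schnyder property at $v$ (edges oriented and colored $0,1,2$): exactly one outgoing edge $e_i(v)$ per color; $e_0(v),e_1(v),e_2(v)$ in counterclockwise order; each edge entering $v$ in color $i$ enters in the counterclockwise sector from $e_{i+1}(v)$ to $e_{i-1}(v)$ (indices mod 3). A Schnyder wood is an orientation and coloring of all edges of $G$ with all vertices satisfying this property (identified with its orientation); crossing means for each pair of distinct colors $i,j$ some monochromatic $i$-cycle meets some monochromatic $j$-cycle. Homology: fixing a reference orientation, the characteristic flow $\phi(W)\in\mathbb Z^E$ of a walk/oriented subgraph counts forward minus backward traversals; a flow is $0$-homologous if it is an integer combination of characteristic flows of counterclockwise facial walks. For orientations $D,D'$, $D\setminus D'$ is the oriented subgraph of $D$ consisting of edges oriented differently in $D'$; $D,D'$ are homologous if $D\setminus D'$ is $0$-homologous. It is known that crossing Schnyder woods exist and are mutually homologous, and every orientation homologous to them is a Schnyder wood; $O(G)$ is the set of these orientations (HTC Schnyder woods). With $F_0$ the counterclockwise facial walk of $f_0$ and $\mathcal F'$ the other counterclockwise facial walks, a $0$-homologous oriented subgraph $T$ is counterclockwise (resp. clockwise) w.r.t. $f_0$ if $\phi(T)=\sum_{F\in\mathcal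 F'}\lambda_F\phi(F)$ with all $\lambda_F\in\mathbb N$ (resp. all $-\lambda_F\in\mathbb N$). $D\le_{f_0}D'$ iff $D\setminus D'$ is counterclockwise w.r.t. $f_0$. It is known that $(O(G),\le_{f_0})$ is a distributive lattice. -}

module Defs where

open import Data.Nat using (ℕ; zero; suc; _+_; _<_)
import Data.Nat as N
open import Data.Fin using (Fin; zero; suc; toℕ; lower₁)
open import Data.Bool using (Bool; true; false; not)
open import Data.Integer using (ℤ; 0ℤ; 1ℤ; _-_; _≤_)
open import Data.Product using (Σ; ∃; _×_; _,_)
open import Data.List using (List; []; _∷_)
open import Relation.Binary.PropositionalEquality using (_≡_; _≢_)
open import Relation.Nullary using (yes; no; ¬_)
open import Function.Bundles using (_⇔_)
open import Function.Definitions using (Surjective)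

-- Darts are Fin n.  σ is the counterclockwise
-- rotation of darts around their origin vertex, α the fixed-point-free
-- involution exchanging the two darts (half-edges) of an edge.
-- The counterclockwise facial walk successor of a dart d (face on the
-- left of d) is σ⁻¹ (α d).

iter : ∀ {A : Set} → (A → A) → ℕ → A → A
iter f zero    x = x
iter f (suc k) x = f (iter f k x)

SameOrbit : ∀ {A : Set} → (A → A) → A → A → Set
SameOrbit f d e = ∃ λ k → iter f k d ≡ e

data Reach {A : Set} (σ α : A → A) : A → A → Set where
  here  : ∀ {d} → Reach σ α d d
  stepσ : ∀ {d e} → Reach σ α (σ d) e → Reach σ α d e
  stepα : ∀ {d e} → Reach σ α (α d) e → Reach σ α d e

OrbitLabelling : ∀ {n} k → (Fin n → Fin n) → (Fin n → Fin k) → Set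
OrbitLabelling k f lab =
  Surjective _≡_ _≡_ lab × (∀ d e → (lab d ≡ lab e) ⇔ SameOrbit f d e)

EdgeLabelling : ∀ {n} k → (Fin n → Fin n) → (Fin n → Fin k) → Set
EdgeLabelling k α lab =
  Surjective _≡_ _≡_ lab × (∀ d e → (lab d ≡ lab e) ⇔ ((d ≡ e) Data.Sum.⊎ (α d ≡ e)))
  where import Data.Sum

-- integer flows on darts (a flow on edges w.r.t. a reference orientation
-- is the same as an antisymmetric function on darts)

b2z : Bool → ℤ
b2z true  = 1ℤ
b2z false = 0ℤ

count : ∀ {n} → Fin n → List (Fin n) → ℤ
count x []       = 0ℤ
count x (y ∷ ys) with x Data.Fin.≟ y
... | yes _ = 1ℤ Data.Integer.+ count x ys
... | no  _ = count x ys

record ToroidalTriangulation : Set where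
  field
    n       : ℕ
    σ σ⁻ α  : Fin n → Fin n
    σσ⁻     : ∀ d → σ (σ⁻ d) ≡ d
    σ⁻σ     : ∀ d → σ⁻ (σ d) ≡ d
    αα      : ∀ d → α (α d) ≡ d
    α-free  : ∀ d → α d ≢ d
    nonempty : 0 < n
    connected : ∀ d e → Reach σ α d e
    nV nE nF : ℕ
    vert    : Fin n → Fin nV
    edge    : Fin n → Fin nE
    face    : Fin n → Fin nF
    vert-lab : OrbitLabelling nV σ vert
    edge-lab : EdgeLabelling nE α edge
    face-lab : OrbitLabelling nF (λ d → σ⁻ (α d)) face
    -- the surface is the torus: Euler characteristic V - E + F = 0
    euler   : nV + nF ≡ nE
    -- all faces are triangles
    triangle  : ∀ d → σ⁻ (α (σ⁻ (α (σ⁻ (α d))))) ≡ d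
    triangle' : ∀ d → σ⁻ (α d) ≢ d

module _ (G : ToroidalTriangulation) where
  open ToroidalTriangulation G

  Dart : Set
  Dart = Fin n

  Flow : Set
  Flow = Dart → ℤ

  χWalk : List Dart → Flow
  χWalk ws x = count x ws - count (α x) ws

  χSub : (Dart → Bool) → Flow
  χSub T x = b2z (T x) - b2z (T (α x))

  -- Σ_F λ_F φ(F) evaluated at x, where φ(F) is the characteristic flow of
  -- the counterclockwise facial walk of F
  faceComb : (Fin nF → ℤ) → Flow
  faceComb λ' x = λ' (face x) - λ' (face (α x))

  ZeroHomologous : Flow → Set
  ZeroHomologous g = ∃ λ (λ' : Fin nF → ℤ) → ∀ x → g x ≡ faceComb λ' x

  CounterclockwiseWrt : Fin nF → Flow → Set
  CounterclockwiseWrt f0 g = ∃ λ (λ' : Fin nF → ℤ) →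
    λ' f0 ≡ 0ℤ × (∀ F → 0ℤ ≤ λ' F) × (∀ x → g x ≡ faceComb λ' x)

  ClockwiseWrt : Fin nF → Flow → Set
  ClockwiseWrt f0 g = ∃ λ (λ' : Fin nF → ℤ) →
    λ' f0 ≡ 0ℤ × (∀ F → λ' F ≤ 0ℤ) × (∀ x → g x ≡ faceComb λ' x)

  -- no contractible (= 0-homologous, on the torus) cycle of length 1 or 2
  NoContractibleShortCycle : Set
  NoContractibleShortCycle =
    (∀ d → vert (α d) ≡ vert d → ¬ ZeroHomologous (χWalk (d ∷ [])))
    × (∀ d₁ d₂ → d₂ ≢ d₁ → d₂ ≢ α d₁ → vert (α d₁) ≡ vert d₂ → vert (α d₂) ≡ vert d₁
         → ¬ ZeroHomologous (χWalk (d₁ ∷ d₂ ∷ [])))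

  -- orientations: out d ≡ true iff the edge of d is oriented away from
  -- the origin of d
  record Orientation : Set where
    field
      out   : Dart → Bool
      out-α : ∀ d → out (α d) ≡ not (out d)
  open Orientation public

  Coloring : Set
  Coloring = Dart → Fin 3

  -- d lies in the counterclockwise sector from a to b around their vertex
  Between : Dart → Dart → Dart → Set
  Between a d b = ∃ λ k → iter σ k a ≡ d × (∀ j → j N.≤ k → iter σ j a ≢ b)

  next3 prev3 : Fin 3 → Fin 3
  next3 zero = suc zero
  next3 (suc zero) = suc (suc zero)
  next3 (suc (suc zero)) = zero
  prev3 zero = suc (suc zero)
  prev3 (suc zero) = zero
  prev3 (suc (suc zero)) = suc zero

  OutAt : Orientation → Coloring → Fin nV → Fin 3 → Dart → Set
  OutAt D c v i e = vert e ≡ v × out D e ≡ true × c e ≡ i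

  SchnyderAt : Orientation → Coloring → Fin nV → Set
  SchnyderAt D c v =
    (∀ i → ∃ λ e → OutAt D c v i e × (∀ e' → OutAt D c v i e' → e' ≡ e))
    × (∀ (e : Fin 3 → Dart) → (∀ i → OutAt D c v i (e i)) →
         Between (e zero) (e (suc zero)) (e (suc (suc zero)))
         × (∀ d i → vert d ≡ v → out D d ≡ false → c d ≡ i →
              Between (e (next3 i)) d (e (prev3 i))))

  record SchnyderWood : Set where
    field
      orient   : Orientation
      color    : Coloring
      color-α  : ∀ d → color (α d) ≡ color d
      schnyder : ∀ v → SchnyderAt orient color v
  open SchnyderWood public

  cyc : ∀ {k} → Fin (suc k) → Fin (suc k)
  cyc {k} j with k Data.Nat.≟ toℕ j
  ... | yes _ = zero
  ... | no ne = suc (lower₁ j ne)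

  record MonoCycle (W : SchnyderWood) (i : Fin 3) : Set where
    field
      len    : ℕ
      darts  : Fin (suc len) → Dart
      isOut  : ∀ j → out (orient W) (darts j) ≡ true
      isCol  : ∀ j → color W (darts j) ≡ i
      linked : ∀ j → vert (α (darts j)) ≡ vert (darts (cyc j))
      simple : ∀ j j' → vert (darts j) ≡ vert (darts j') → j ≡ j'
  open MonoCycle public

  Crossing : SchnyderWood → Set
  Crossing W = ∀ i j → i ≢ j →
    ∃ λ (C : MonoCycle W i) → ∃ λ (C' : MonoCycle W j) →
      ∃ λ a → ∃ λ b → vert (darts C a) ≡ vert (darts C' b)

  Diff : Orientation → Orientation → Dart → Bool
  Diff D D' d = out D d Data.Bool.∧ not (out D' d)

  Homologous : Orientation → Orientation → Set
  Homologous D D' = ZeroHomologous (χSub (Diff D D'))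

  InO : Orientation → Set
  InO D = ∃ λ (W : SchnyderWood) → Crossing W × Homologous D (orient W)

  _≤[_]_ : Orientation → Fin nF → Orientation → Set
  D ≤[ f0 ] D' = CounterclockwiseWrt f0 (χSub (Diff D D'))

  IsMinimal : Fin nF → Orientation → Set
  IsMinimal f0 m = InO m × (∀ D → InO D → m ≤[ f0 ] D)

  NoClockwiseSub : Fin nF → Orientation → Set
  NoClockwiseSub f0 D = ∀ (T : Dart → Bool) →
    (∀ d → T d ≡ true → out D d ≡ true) →
    (∃ λ d → T d ≡ true) →
    ZeroHomologous (χSub T) → ¬ ClockwiseWrt f0 (χSub T)

  SameOrientation : Orientation → Orientation → Set
  SameOrientation D D' = ∀ d → out D d ≡ out D' d

-- Reversing a 0-homologous subgraph of an element of O(G) stays in O(G).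
-- On a connected map a flow has a unique representation Σ λ_F φ(F) with
-- λ_{f0} = 0, since the faces-to-flows map has only the constants in its
-- kernel; hence a nonzero flow cannot be both counterclockwise and clockwise
-- w.r.t. f0.  If the minimum m contained a nonempty clockwise T, reversing T
-- would give D ∈ O(G) with m ≤ D, making T counterclockwise too.  If D ∈ O(G)
-- has no clockwise subgraph, then D ∖ m, which is clockwise because m ∖ D is
-- counterclockwise, is empty, so D = m.

module Submission where

open import Defs
open import Data.Fin using (Fin)
open import Data.Product using (_×_)

open import Data.Bool using (Bool; true; false; not; _∧_; _∨_; _xor_)
open import Data.Bool.Properties using (∨-comm; not-involutive; not-distribˡ-xor; ¬-not)
open import Data.Integer using (ℤ; 0ℤ; 1ℤ; _+_; _-_; -_; _≤_)
open import Data.Integer.Properties using (i-j≡0⇒i≡j; i≡j⇒i-j≡0; ≤-antisym; neg-mono-≤)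
open import Data.Integer.Tactic.RingSolver using (solve-∀)
open import Data.Product using (_,_; proj₁; proj₂)
open import Function.Bundles using (Equivalence)
open import Relation.Binary.PropositionalEquality

b2z-∧-not : ∀ o o' → b2z (o ∧ not o') - b2z (not o ∧ not (not o')) ≡ b2z o - b2z o'
b2z-∧-not true  true  = refl
b2z-∧-not true  false = refl
b2z-∧-not false true  = refl
b2z-∧-not false false = refl

∧-not-xor-∨ : ∀ o t t' → (t ≡ true → o ≡ true) → (t' ≡ true → o ≡ false) →
  o ∧ not (o xor (t ∨ t')) ≡ t
∧-not-xor-∨ true  true  false _ _ = refl
∧-not-xor-∨ true  false false _ _ = refl
∧-not-xor-∨ true  _     true  _ t'⇒¬o with t'⇒¬o refl
... | ()
∧-not-xor-∨ false true  _     t⇒o _ with t⇒o refl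
... | ()
∧-not-xor-∨ false false _     _ _ = refl

∧-not-false⇒≡ : ∀ o o' → o ∧ not o' ≡ false → not o ∧ not (not o') ≡ false → o ≡ o'
∧-not-false⇒≡ true  true  _  _  = refl
∧-not-false⇒≡ true  false () _
∧-not-false⇒≡ false true  _  ()
∧-not-false⇒≡ false false _  _  = refl

module _ (G : ToroidalTriangulation) where
  open ToroidalTriangulation G

  faceComb-+ : ∀ l l' x →
    faceComb G (λ F → l F + l' F) x ≡ faceComb G l x + faceComb G l' x
  faceComb-+ l l' x = identity (l (face x)) (l (face (α x))) (l' (face x)) (l' (face (α x)))
    where
      identity : ∀ a b c d → (a + c) - (b + d) ≡ (a - b) + (c - d)
      identity = solve-∀

  faceComb-minus : ∀ l l' x →
    faceComb G (λ F → l F - l' F) x ≡ faceComb G l x - faceComb G l' x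
  faceComb-minus l l' x = identity (l (face x)) (l (face (α x))) (l' (face x)) (l' (face (α x)))
    where
      identity : ∀ a b c d → (a - c) - (b - d) ≡ (a - b) - (c - d)
      identity = solve-∀

  faceComb-neg : ∀ l x → faceComb G (λ F → - l F) x ≡ - faceComb G l x
  faceComb-neg l x = identity (l (face x)) (l (face (α x)))
    where
      identity : ∀ a b → (- a) - (- b) ≡ - (a - b)
      identity = solve-∀

  face-α∘σ : ∀ d → face (α (σ d)) ≡ face d
  face-α∘σ d = Equivalence.from (proj₂ face-lab (α (σ d)) d)
    (1 , trans (cong σ⁻ (αα (σ d))) (σ⁻σ d))

  module _ (μ : Fin nF → ℤ) (μ-closed : ∀ x → faceComb G μ x ≡ 0ℤ) where

    private
      across : ∀ d → μ (face d) ≡ μ (face (α d))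
      across d = i-j≡0⇒i≡j _ _ (μ-closed d)

    faceComb≡0⇒Reach-invariant : ∀ {d e} → Reach σ α d e → μ (face d) ≡ μ (face e)
    faceComb≡0⇒Reach-invariant here = refl
    faceComb≡0⇒Reach-invariant (stepσ {d} r) =
      trans (cong μ (sym (face-α∘σ d)))
        (trans (sym (across (σ d))) (faceComb≡0⇒Reach-invariant r))
    faceComb≡0⇒Reach-invariant (stepα {d} r) =
      trans (across d) (faceComb≡0⇒Reach-invariant r)

    faceComb≡0⇒constant : ∀ F F' → μ F ≡ μ F'
    faceComb≡0⇒constant F F' with proj₁ face-lab F | proj₁ face-lab F'
    ... | d , face-d | e , face-e =
      trans (cong μ (sym (face-d refl)))
        (trans (faceComb≡0⇒Reach-invariant (connected d e)) (cong μ (face-e refl)))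

  faceComb-injective : ∀ f0 l l' → (∀ x → faceComb G l x ≡ faceComb G l' x) →
    l f0 ≡ l' f0 → ∀ F → l F ≡ l' F
  faceComb-injective f0 l l' same same-f0 F =
    i-j≡0⇒i≡j _ _ (trans (faceComb≡0⇒constant μ μ-closed F f0) (i≡j⇒i-j≡0 same-f0))
    where
      μ : Fin nF → ℤ
      μ F = l F - l' F
      μ-closed : ∀ x → faceComb G μ x ≡ 0ℤ
      μ-closed x = trans (faceComb-minus l l' x) (i≡j⇒i-j≡0 (same x))

  counterclockwise∧clockwise⇒zero : ∀ f0 g →
    CounterclockwiseWrt G f0 g → ClockwiseWrt G f0 g → ∀ x → g x ≡ 0ℤ
  counterclockwise∧clockwise⇒zero f0 g (l , l-f0 , l≥0 , g≡l) (l' , l'-f0 , l'≤0 , g≡l') x =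
    trans (g≡l x) (cong₂ _-_ (l≡0 (face x)) (l≡0 (face (α x))))
    where
      l≡l' : ∀ F → l F ≡ l' F
      l≡l' = faceComb-injective f0 l l' (λ y → trans (sym (g≡l y)) (g≡l' y))
        (trans l-f0 (sym l'-f0))
      l≡0 : ∀ F → l F ≡ 0ℤ
      l≡0 F = ≤-antisym (subst (_≤ 0ℤ) (sym (l≡l' F)) (l'≤0 F)) (l≥0 F)

  ZeroHomologous-resp : ∀ {g h} → (∀ x → g x ≡ h x) → ZeroHomologous G h → ZeroHomologous G g
  ZeroHomologous-resp g≡h (l , h≡l) = l , λ x → trans (g≡h x) (h≡l x)

  ZeroHomologous-+ : ∀ {g h} → ZeroHomologous G g → ZeroHomologous G h →
    ZeroHomologous G (λ x → g x + h x)
  ZeroHomologous-+ (l , g≡l) (l' , h≡l') =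
    (λ F → l F + l' F) , λ x → trans (cong₂ _+_ (g≡l x) (h≡l' x)) (sym (faceComb-+ l l' x))

  ZeroHomologous-neg : ∀ {g} → ZeroHomologous G g → ZeroHomologous G (λ x → - g x)
  ZeroHomologous-neg (l , g≡l) =
    (λ F → - l F) , λ x → trans (cong -_ (g≡l x)) (sym (faceComb-neg l x))

  ClockwiseWrt⇒ZeroHomologous : ∀ {f0 g} → ClockwiseWrt G f0 g → ZeroHomologous G g
  ClockwiseWrt⇒ZeroHomologous (l , _ , _ , g≡l) = l , g≡l

  CounterclockwiseWrt-resp : ∀ {f0 g h} → (∀ x → g x ≡ h x) →
    CounterclockwiseWrt G f0 h → CounterclockwiseWrt G f0 g
  CounterclockwiseWrt-resp g≡h (l , l-f0 , l≥0 , h≡l) =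
    l , l-f0 , l≥0 , λ x → trans (g≡h x) (h≡l x)

  χSub-Diff : ∀ D D' x → χSub G (Diff G D D') x ≡ b2z (out D x) - b2z (out D' x)
  χSub-Diff D D' x rewrite out-α D x | out-α D' x = b2z-∧-not (out D x) (out D' x)

  χSub-Diff-swap : ∀ D D' x → χSub G (Diff G D' D) x ≡ - χSub G (Diff G D D') x
  χSub-Diff-swap D D' x rewrite χSub-Diff D' D x | χSub-Diff D D' x =
    identity (b2z (out D x)) (b2z (out D' x))
    where
      identity : ∀ a b → b - a ≡ - (a - b)
      identity = solve-∀

  χSub-Diff-trans : ∀ D D' D'' x →
    χSub G (Diff G D D'') x ≡ χSub G (Diff G D D') x + χSub G (Diff G D' D'') x
  χSub-Diff-trans D D' D'' x
    rewrite χSub-Diff D D'' x | χSub-Diff D D' x | χSub-Diff D' D'' x =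
    identity (b2z (out D x)) (b2z (out D' x)) (b2z (out D'' x))
    where
      identity : ∀ a b c → a - c ≡ (a - b) + (b - c)
      identity = solve-∀

  Homologous-sym : ∀ D D' → Homologous G D D' → Homologous G D' D
  Homologous-sym D D' h = ZeroHomologous-resp (χSub-Diff-swap D D') (ZeroHomologous-neg h)

  Homologous-trans : ∀ D D' D'' → Homologous G D D' → Homologous G D' D'' → Homologous G D D''
  Homologous-trans D D' D'' h h' =
    ZeroHomologous-resp (χSub-Diff-trans D D' D'') (ZeroHomologous-+ h h')

  InO-resp-Homologous : ∀ D D' → Homologous G D D' → InO G D' → InO G D
  InO-resp-Homologous D D' h (W , crossing , h') =
    W , crossing , Homologous-trans D D' (orient W) h h'

  ≤⇒Diff-clockwise : ∀ f0 D D' → _≤[_]_ G D f0 D' →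
    ClockwiseWrt G f0 (χSub G (Diff G D' D))
  ≤⇒Diff-clockwise f0 D D' (l , l-f0 , l≥0 , g≡l) =
    (λ F → - l F) , cong -_ l-f0 , (λ F → neg-mono-≤ (l≥0 F)) ,
    λ x → trans (χSub-Diff-swap D D' x) (trans (cong -_ (g≡l x)) (sym (faceComb-neg l x)))

  Diff-⊆ : ∀ D D' d → Diff G D D' d ≡ true → out D d ≡ true
  Diff-⊆ D D' d with out D d
  ... | true  = λ _ → refl
  ... | false = λ ()

  Diff≡false⇒SameOrientation : ∀ D D' → (∀ d → Diff G D D' d ≡ false) → SameOrientation G D D'
  Diff≡false⇒SameOrientation D D' empty d =
    ∧-not-false⇒≡ (out D d) (out D' d) (empty d)
      (trans (sym (cong₂ (λ a b → a ∧ not b) (out-α D d) (out-α D' d))) (empty (α d)))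

  _⊆_ : (Dart G → Bool) → Orientation G → Set
  T ⊆ D = ∀ d → T d ≡ true → out D d ≡ true

  module _ (T : Dart G → Bool) (D : Orientation G) (T⊆D : T ⊆ D) where

    ⊆-opposite : ∀ d → T (α d) ≡ true → out D d ≡ false
    ⊆-opposite d Tαd =
      trans (sym (not-involutive (out D d))) (cong not (trans (sym (out-α D d)) (T⊆D (α d) Tαd)))

    ⊆-antisymmetric : ∀ d → T d ≡ true → T (α d) ≡ false
    ⊆-antisymmetric d Td =
      ¬-not λ Tαd → true≢false (trans (sym (T⊆D d Td)) (⊆-opposite d Tαd))
      where
        true≢false : true ≢ false
        true≢false ()

    χSub-⊆≡1 : ∀ d → T d ≡ true → χSub G T d ≡ 1ℤ
    χSub-⊆≡1 d Td rewrite Td | ⊆-antisymmetric d Td = refl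

  reverse : Orientation G → (Dart G → Bool) → Orientation G
  reverse D T = record
    { out   = λ d → out D d xor (T d ∨ T (α d))
    ; out-α = λ d → trans (cong₂ (λ o t → o xor (T (α d) ∨ T t)) (out-α D d) (αα d))
                      (trans (cong (not (out D d) xor_) (∨-comm (T (α d)) (T d)))
                        (sym (not-distribˡ-xor (out D d) (T d ∨ T (α d)))))
    }

  module _ (T : Dart G → Bool) (D : Orientation G) (T⊆D : T ⊆ D) where

    Diff-reverse : ∀ d → Diff G D (reverse D T) d ≡ T d
    Diff-reverse d = ∧-not-xor-∨ (out D d) (T d) (T (α d)) (T⊆D d) (⊆-opposite T D T⊆D d)

    χSub-Diff-reverse : ∀ x → χSub G (Diff G D (reverse D T)) x ≡ χSub G T x
    χSub-Diff-reverse x = cong₂ (λ a b → b2z a - b2z b) (Diff-reverse x) (Diff-reverse (α x))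

    reverse-Homologous : ZeroHomologous G (χSub G T) → Homologous G (reverse D T) D
    reverse-Homologous zT =
      Homologous-sym D (reverse D T) (ZeroHomologous-resp χSub-Diff-reverse zT)

  IsMinimal⇒NoClockwiseSub : ∀ f0 m → IsMinimal G f0 m → NoClockwiseSub G f0 m
  IsMinimal⇒NoClockwiseSub f0 m (m∈O , m-least) T T⊆m (d , Td) zT clockwise =
    1≢0 (trans (sym (χSub-⊆≡1 T m T⊆m d Td))
      (counterclockwise∧clockwise⇒zero f0 (χSub G T) counterclockwise clockwise d))
    where
      counterclockwise : CounterclockwiseWrt G f0 (χSub G T)
      counterclockwise = CounterclockwiseWrt-resp (λ x → sym (χSub-Diff-reverse T m T⊆m x))
        (m-least (reverse m T)
          (InO-resp-Homologous (reverse m T) m (reverse-Homologous T m T⊆m zT) m∈O))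
      1≢0 : 1ℤ ≢ 0ℤ
      1≢0 ()

  NoClockwiseSub⇒SameOrientation-minimal : ∀ f0 m → IsMinimal G f0 m →
    ∀ D → InO G D → NoClockwiseSub G f0 D → SameOrientation G D m
  NoClockwiseSub⇒SameOrientation-minimal f0 m (_ , m-least) D D∈O no-clockwise =
    Diff≡false⇒SameOrientation D m λ d → ¬-not λ Diff-d →
      no-clockwise (Diff G D m) (Diff-⊆ D m) (d , Diff-d)
        (ClockwiseWrt⇒ZeroHomologous clockwise) clockwise
    where
      clockwise : ClockwiseWrt G f0 (χSub G (Diff G D m))
      clockwise = ≤⇒Diff-clockwise f0 m D (m-least D D∈O)

lemma1 : (G : ToroidalTriangulation) → NoContractibleShortCycle G →
    (f0 : Fin (ToroidalTriangulation.nF G)) → (m : Orientation G) →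
    IsMinimal G f0 m →
    NoClockwiseSub G f0 m ×
      ((D : Orientation G) → InO G D → NoClockwiseSub G f0 D → SameOrientation G D m)
lemma1 G _ f0 m minimal =
  IsMinimal⇒NoClockwiseSub G f0 m minimal , NoClockwiseSub⇒SameOrientation-minimal G f0 m minimal
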